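{- Let $G$ be a minimal counterexample as described in the context. Then $G$ contains no vertex $v$ of degree $8$ together with distinct neighbours $w_1,w_2,w_3,w_4,w_5,w_6$ of $v$ and a vertex $x\notin N(v)\cup\{v\}$ such that $w_1w_2,\ w_2w_3,\ w_3w_4,\ w_5w_6,\ xw_4,\ xw_5\in E(G)$ and $d(w_2)=d(w_4)=d(w_5)=3$.
   Context: A total $9$-coloring of a graph assigns to every vertex and every edge one of $9$ colors so that adjacent vertices, edges sharing an endpoint, and a vertex and an edge incident to it all receive different colors. A $4$-fan is a path $x_1x_2x_3x_4x_5$ together with one further vertex adjacent to all of $x_1,\dots,x_5$. A minimal counterexample is a simple planar graph $G$ of maximum degree $8$ containing no subgraph isomorphic to a $4$-fan, having no total $9$-coloring, with $|V(G)|+|E(G)|$ minimum among all such graphs; as part of this standing assumption, for every $x\in V(G)\cup E(G)$ the graph $G-x$ admits a total $9$-coloring. $N(v)$ is the neighbourhood of $v$ and $d(\cdot)$ denotes degree. (In the paper this is the configuration of Figure 6(a): three consecutive triangles $vw_1w_2, vw_2w_3, vw_3w_4$, a triangle $vw_5w_6$, and a $4$-cycle $vw_4xw_5$, the remaining two neighbours of $v$ arbitrary.) -}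

module Defs where

open import Data.Nat using (ℕ; zero; suc; _+_; _*_; _<_; _≤_; _<ᵇ_; _≡ᵇ_)
open import Data.Bool using (Bool; true; false; _∧_; _∨_; not; if_then_else_)
open import Data.Fin using (Fin; toℕ; punchIn; _≟_)
open import Data.Product using (Σ; ∃; _×_; _,_)
open import Data.Unit using (⊤)
open import Data.List using (List; []; _∷_)
open import Data.List.Relation.Unary.Unique.Propositional using (Unique)
open import Relation.Nullary using (¬_)
open import Relation.Nullary.Decidable using (⌊_⌋)
open import Relation.Binary.PropositionalEquality using (_≡_; _≢_)
open import Relation.Binary.Construct.Closure.ReflexiveTransitive using (Star)
open import Function.Bundles using (_⇔_)

Adj : ℕ → Set
Adj n = Fin n → Fin n → Bool

record IsSimple {n : ℕ} (adj : Adj n) : Set where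
  field
    symm   : ∀ u v → adj u v ≡ adj v u
    irrefl : ∀ u → adj u u ≡ false

countTrue : ∀ {n} → (Fin n → Bool) → ℕ
countTrue {zero}  p = 0
countTrue {suc n} p = (if p Fin.zero then 1 else 0) + countTrue (λ i → p (Fin.suc i))

sumFin : ∀ {n} → (Fin n → ℕ) → ℕ
sumFin {zero}  f = 0
sumFin {suc n} f = f Fin.zero + sumFin (λ i → f (Fin.suc i))

deg : ∀ {n} → Adj n → Fin n → ℕ
deg adj v = countTrue (adj v)

edgeCount : ∀ {n} → Adj n → ℕ
edgeCount adj = sumFin (λ u → countTrue (λ w → adj u w ∧ (toℕ u <ᵇ toℕ w)))

isolatedCount : ∀ {n} → Adj n → ℕ
isolatedCount adj = countTrue (λ v → deg adj v ≡ᵇ 0)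

size : ∀ {n} → Adj n → ℕ
size {n} adj = n + edgeCount adj

MaxDegree : ∀ {n} → Adj n → ℕ → Set
MaxDegree adj Δ = (∀ v → deg adj v ≤ Δ) × ∃ λ v → deg adj v ≡ Δ

record TotalColoring (k : ℕ) {n : ℕ} (adj : Adj n) : Set where
  field
    vcol : Fin n → Fin k
    ecol : Fin n → Fin n → Fin k      -- only meaningful on edges
    ecol-sym  : ∀ u v → adj u v ≡ true → ecol u v ≡ ecol v u
    vv-proper : ∀ u v → adj u v ≡ true → vcol u ≢ vcol v
    ee-proper : ∀ u v w → adj u v ≡ true → adj u w ≡ true → v ≢ w →
                ecol u v ≢ ecol u w
    ve-proper : ∀ u v → adj u v ≡ true → vcol u ≢ ecol u v

deleteVertex : ∀ {k} → Adj (suc k) → Fin (suc k) → Adj k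
deleteVertex adj v a b = adj (punchIn v a) (punchIn v b)

deleteEdge : ∀ {n} → Adj n → Fin n → Fin n → Adj n
deleteEdge adj u v a b =
  adj a b ∧ not ((⌊ a ≟ u ⌋ ∧ ⌊ b ≟ v ⌋) ∨ (⌊ a ≟ v ⌋ ∧ ⌊ b ≟ u ⌋))

AllVertexDeletionsColorable : ℕ → ∀ {n} → Adj n → Set
AllVertexDeletionsColorable k {zero}  adj = ⊤
AllVertexDeletionsColorable k {suc n} adj =
  ∀ v → TotalColoring k (deleteVertex adj v)

AllEdgeDeletionsColorable : ℕ → ∀ {n} → Adj n → Set
AllEdgeDeletionsColorable k adj =
  ∀ u v → adj u v ≡ true → TotalColoring k (deleteEdge adj u v)

Has4Fan : ∀ {n} → Adj n → Set
Has4Fan adj = ∃ λ y → ∃ λ x₁ → ∃ λ x₂ → ∃ λ x₃ → ∃ λ x₄ → ∃ λ x₅ →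
  Unique (y ∷ x₁ ∷ x₂ ∷ x₃ ∷ x₄ ∷ x₅ ∷ []) ×
  (adj x₁ x₂ ≡ true × adj x₂ x₃ ≡ true × adj x₃ x₄ ≡ true × adj x₄ x₅ ≡ true) ×
  (adj y x₁ ≡ true × adj y x₂ ≡ true × adj y x₃ ≡ true × adj y x₄ ≡ true ×
   adj y x₅ ≡ true)

-- Planarity, combinatorially: existence of a rotation system whose
-- face count satisfies Euler's formula on every component
-- (V - E + F + #isolated = 2 * #components), i.e. genus 0.

iter : ∀ {A : Set} → (A → A) → ℕ → A → A
iter f zero    x = x
iter f (suc k) x = f (iter f k x)

record PlanarEmbedding {n : ℕ} (adj : Adj n) : Set where
  field
    rot     : Fin n → Fin n → Fin n
    rot-adj : ∀ v u → adj v u ≡ true → adj v (rot v u) ≡ true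
    rot-inj : ∀ v u u′ → adj v u ≡ true → adj v u′ ≡ true →
              rot v u ≡ rot v u′ → u ≡ u′
    rot-cyc : ∀ v u u′ → adj v u ≡ true → adj v u′ ≡ true →
              ∃ λ k → iter (rot v) k u ≡ u′
  -- face-tracing permutation on darts (u , v)
  φ : Fin n × Fin n → Fin n × Fin n
  φ (u , v) = (v , rot v u)
  field
    faces      : ℕ
    face       : (u v : Fin n) → adj u v ≡ true → Fin faces
    face-surj  : ∀ i → ∃ λ u → ∃ λ v → ∃ λ (p : adj u v ≡ true) → face u v p ≡ i
    face-orbit : ∀ u v (p : adj u v ≡ true) u′ v′ (p′ : adj u′ v′ ≡ true) →
                 (face u v p ≡ face u′ v′ p′) ⇔ (∃ λ k → iter φ k (u , v) ≡ (u′ , v′))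
    comps     : ℕ
    comp      : Fin n → Fin comps
    comp-surj : ∀ i → ∃ λ v → comp v ≡ i
    comp-conn : ∀ u v → (comp u ≡ comp v) ⇔ Star (λ a b → adj a b ≡ true) u v
    euler : n + faces + isolatedCount adj ≡ 2 * comps + edgeCount adj

Planar : ∀ {n} → Adj n → Set
Planar adj = PlanarEmbedding adj

InClass : ∀ {n} → Adj n → Set
InClass adj = IsSimple adj × Planar adj × MaxDegree adj 8 × ¬ Has4Fan adj

record MinimalCounterexample {n : ℕ} (adj : Adj n) : Set₁ where
  field
    inClass      : InClass adj
    notColorable : ¬ TotalColoring 9 adj
    minimal      : ∀ m (H : Adj m) → InClass H → size H < size adj →
                   TotalColoring 9 H
    vertexDel    : AllVertexDeletionsColorable 9 adj
    edgeDel      : AllEdgeDeletionsColorable 9 adj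

Config : ∀ {n} → Adj n → Set
Config adj = ∃ λ v → ∃ λ w₁ → ∃ λ w₂ → ∃ λ w₃ → ∃ λ w₄ → ∃ λ w₅ → ∃ λ w₆ → ∃ λ x →
  deg adj v ≡ 8 ×
  Unique (w₁ ∷ w₂ ∷ w₃ ∷ w₄ ∷ w₅ ∷ w₆ ∷ []) ×
  (adj v w₁ ≡ true × adj v w₂ ≡ true × adj v w₃ ≡ true ×
   adj v w₄ ≡ true × adj v w₅ ≡ true × adj v w₆ ≡ true) ×
  (x ≢ v × adj v x ≡ false) ×
  (adj w₁ w₂ ≡ true × adj w₂ w₃ ≡ true × adj w₃ w₄ ≡ true ×
   adj w₅ w₆ ≡ true × adj x w₄ ≡ true × adj x w₅ ≡ true) ×
  (deg adj w₂ ≡ 3 × deg adj w₄ ≡ 3 × deg adj w₅ ≡ 3)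

-- Delete the edge vw₄; by minimality G − vw₄ has a total 9-colouring φ, in which v sees only eight
-- colours, so some colour α is missing at v.  A finite case analysis on the coincidences among α
-- and the colours of vw₁, vw₂, vw₃, vw₅, w₁w₂, w₂w₃, w₃w₄, w₄x, w₅x, w₅w₆ permutes the colours on
-- vw₁, …, vw₅, w₁w₂, w₂w₃, w₃w₄ so that vw₄ gets a colour while the stars of v, w₁, w₃ stay proper.
-- The degree-3 vertices w₂, w₄, w₅ are then recoloured, each avoiding the six colours on its
-- neighbours and incident edges, which yields a total 9-colouring of G.
module Submission where

open import Defs
open import Data.Bool using (Bool; true; false; _∧_; _∨_; not; if_then_else_)
open import Data.Bool.Properties using (∧-identityʳ; ∨-identityʳ)
open import Data.Empty using (⊥-elim)
open import Data.Fin using (Fin; _≟_; toℕ; #_)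
import Data.Fin as Fin
open import Data.Fin.Properties using (any?; pigeonhole; ¬∀⟶∃¬; <⇒≢)
open import Data.List using (List; []; _∷_; length; map; lookup; mapMaybe; allFin)
open import Data.List.Properties using (length-map)
open import Data.List.Membership.Propositional using (_∈_; _∉_)
open import Data.List.Membership.Propositional.Properties using (∈-map⁺; ∈-map⁻; ∈-lookup; ∈-allFin; ∈-++⁺ˡ)
import Data.List.Membership.DecPropositional as DecMembership
open import Data.List.Relation.Binary.Permutation.Propositional
  using (_↭_; refl; prep; swap; ↭-sym; ↭⇒↭ₛ) renaming (trans to ↭-trans)
open import Data.List.Relation.Binary.Permutation.Propositional.Properties using (shift; ∈-resp-↭)
import Data.List.Relation.Binary.Permutation.Setoid.Properties as Permutation
open import Data.List.Relation.Unary.All as All using (All; []; _∷_)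
open import Data.List.Relation.Unary.All.Properties using (All¬⇒¬Any)
import Data.List.Relation.Unary.All.Properties as All
open import Data.List.Relation.Unary.AllPairs using ([]; _∷_)
open import Data.List.Relation.Unary.Any as Any using (here; there)
open import Data.List.Relation.Unary.Any.Properties using (lookup-index)
open import Data.List.Relation.Unary.Unique.Propositional using (Unique)
import Data.List.Relation.Unary.Unique.Propositional.Properties as Unique
open import Data.List.Relation.Unary.Unique.Propositional.Properties using (take⁺)
open import Data.List.Relation.Unary.Unique.DecPropositional using (unique?)
open import Data.Maybe using (Maybe; just; nothing; fromMaybe)
import Data.Maybe as Maybe
open import Data.Nat using (ℕ; zero; suc; _+_; _<_; _⊓_; _⊔_)
open import Data.Nat.Properties using (suc-injective; ≤-refl; m≤m+n; ⊓-comm; ⊔-comm)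
open import Data.Product as Product using (∃; ∃₂; _×_; _,_; proj₁; proj₂)
open import Data.Sum as Sum using (_⊎_; inj₁; inj₂)
open import Function using (_∘_)
open import Relation.Binary.Definitions using (DecidableEquality)
open import Relation.Binary.PropositionalEquality
open import Relation.Nullary using (¬_; yes; no)
open import Relation.Nullary.Decidable using (⌊_⌋; _×-dec_; True; False; toWitness; toWitnessFalse)

countTrue-cong : ∀ {n} {p q : Fin n → Bool} → (∀ z → p z ≡ q z) → countTrue p ≡ countTrue q
countTrue-cong {zero}  p≗q = refl
countTrue-cong {suc n} p≗q =
  cong₂ (λ b m → (if b then 1 else 0) + m) (p≗q Fin.zero) (countTrue-cong (λ z → p≗q (Fin.suc z)))

countTrue≡0 : ∀ {n} {p : Fin n → Bool} → countTrue p ≡ 0 → ∀ z → p z ≡ false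
countTrue≡0 {p = p} _ Fin.zero with p Fin.zero
... | false = refl
countTrue≡0 {p = p} count≡0 (Fin.suc z) with p Fin.zero
... | false = countTrue≡0 count≡0 z

without : ∀ {n} → (Fin n → Bool) → Fin n → Fin n → Bool
without p a z = p z ∧ not ⌊ z ≟ a ⌋

without-true : ∀ {n} (p : Fin n → Bool) {a z} → p z ≡ true → z ≢ a → without p a z ≡ true
without-true p {a} {z} pz z≢a with z ≟ a
... | yes z≡a = ⊥-elim (z≢a z≡a)
... | no _ rewrite pz = refl

without-suc : ∀ {n} (p : Fin (suc n) → Bool) a z →
              without (λ y → p (Fin.suc y)) a z ≡ without p (Fin.suc a) (Fin.suc z)
without-suc p a z with z ≟ a
... | yes _ = refl
... | no _  = refl

countTrue-without : ∀ {n} (p : Fin n → Bool) {a} → p a ≡ true →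
                    countTrue p ≡ suc (countTrue (without p a))
countTrue-without {suc n} p {Fin.zero} pa rewrite pa =
  cong suc (countTrue-cong (λ z → sym (∧-identityʳ (p (Fin.suc z)))))
countTrue-without {suc n} p {Fin.suc a} pa
  rewrite countTrue-without (λ z → p (Fin.suc z)) pa | countTrue-cong (without-suc p a) with p Fin.zero
... | true  = refl
... | false = refl

countTrue-exhausted : ∀ {n} {p : Fin n → Bool} {xs} → countTrue p ≡ length xs → Unique xs →
                      All (λ y → p y ≡ true) xs → ∀ {z} → p z ≡ true → z ∈ xs
countTrue-exhausted {xs = []} count≡0 [] [] {z} pz with () ← trans (sym pz) (countTrue≡0 count≡0 z)
countTrue-exhausted {p = p} {a ∷ as} count≡ (a∉as ∷ unique-as) (pa ∷ p-as) {z} pz with z ≟ a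
... | yes refl = here refl
... | no z≢a   = there (countTrue-exhausted count-without unique-as without-as (without-true p pz z≢a))
  where
  count-without : countTrue (without p a) ≡ length as
  count-without = suc-injective (trans (sym (countTrue-without p pa)) count≡)
  without-as : All (λ y → without p a y ≡ true) as
  without-as = All.zipWith (λ (py , a≢y) → without-true p py (≢-sym a≢y)) (p-as , a∉as)

trues : ∀ {n} → (Fin n → Bool) → List (Fin n)
trues {zero}  p = []
trues {suc n} p with p Fin.zero
... | true  = Fin.zero ∷ map Fin.suc (trues (λ z → p (Fin.suc z)))
... | false = map Fin.suc (trues (λ z → p (Fin.suc z)))

length-trues : ∀ {n} (p : Fin n → Bool) → length (trues p) ≡ countTrue p
length-trues {zero}  p = refl
length-trues {suc n} p with p Fin.zero
... | true  = cong suc (trans (length-map Fin.suc (trues (p ∘ Fin.suc))) (length-trues (p ∘ Fin.suc)))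
... | false = trans (length-map Fin.suc (trues (p ∘ Fin.suc))) (length-trues (p ∘ Fin.suc))

∈-trues : ∀ {n} (p : Fin n → Bool) {z} → p z ≡ true → z ∈ trues p
∈-trues {suc n} p {Fin.zero} pz with p Fin.zero
... | true = here refl
∈-trues {suc n} p {Fin.suc z} pz with p Fin.zero
... | true  = there (∈-map⁺ Fin.suc (∈-trues (λ y → p (Fin.suc y)) pz))
... | false = ∈-map⁺ Fin.suc (∈-trues (λ y → p (Fin.suc y)) pz)

∃-∉ : ∀ {k} (xs : List (Fin k)) → length xs < k → ∃ (_∉ xs)
∃-∉ {k} xs short = ¬∀⟶∃¬ k (_∈ xs) (_∈? xs) all-in
  where
  open DecMembership (_≟_ {k}) using (_∈?_)
  all-in : ¬ (∀ c → c ∈ xs)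
  all-in every with pigeonhole short (λ c → Any.index (every c))
  ... | i , j , i<j , same-index = <⇒≢ i<j
    (trans (lookup-index (every i)) (trans (cong (lookup xs) same-index) (sym (lookup-index (every j)))))

distinct₃ : ∀ {A : Set} {x y z : A} → x ≢ y → x ≢ z → y ≢ z → Unique (x ∷ y ∷ z ∷ [])
distinct₃ x≢y x≢z y≢z = (x≢y ∷ x≢z ∷ []) ∷ (y≢z ∷ []) ∷ [] ∷ []

Unique-resp-↭ : ∀ {A : Set} {xs ys : List A} → xs ↭ ys → Unique xs → Unique ys
Unique-resp-↭ {A} xs↭ys = Permutation.Unique-resp-↭ (setoid A) (↭⇒↭ₛ xs↭ys)

lookup-injective : ∀ {A : Set} {xs : List A} → Unique xs → ∀ {i j} → lookup xs i ≡ lookup xs j → i ≡ j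
lookup-injective {xs = _ ∷ _} _          {Fin.zero}  {Fin.zero}  _   = refl
lookup-injective {xs = _ ∷ _} (x∉ ∷ _)   {Fin.zero}  {Fin.suc j} x≡  = ⊥-elim (All.lookup x∉ (∈-lookup j) x≡)
lookup-injective {xs = _ ∷ _} (x∉ ∷ _)   {Fin.suc i} {Fin.zero}  ≡x  = ⊥-elim (All.lookup x∉ (∈-lookup i) (sym ≡x))
lookup-injective {xs = _ ∷ _} (_ ∷ uniq) {Fin.suc i} {Fin.suc j} eq  = cong Fin.suc (lookup-injective uniq eq)

∈-mapMaybe⁺ : ∀ {A B : Set} {f : A → Maybe B} {x y} {xs : List A} →
              x ∈ xs → f x ≡ just y → y ∈ mapMaybe f xs
∈-mapMaybe⁺ {f = f} {x} (here refl) fx≡y with f x | fx≡y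
... | just _ | refl = here refl
∈-mapMaybe⁺ {f = f} {xs = x′ ∷ _} (there x∈xs) fx≡y with f x′
... | just _  = there (∈-mapMaybe⁺ x∈xs fx≡y)
... | nothing = ∈-mapMaybe⁺ x∈xs fx≡y

∈-mapMaybe⁻ : ∀ {A B : Set} {f : A → Maybe B} {y} (xs : List A) →
              y ∈ mapMaybe f xs → ∃ λ x → f x ≡ just y
∈-mapMaybe⁻ {f = f} (x ∷ xs) y∈ with f x in fx≡
∈-mapMaybe⁻ {f = f} (x ∷ xs) (here refl)  | just _  = x , fx≡
∈-mapMaybe⁻ {f = f} (x ∷ xs) (there y∈)   | just _  = ∈-mapMaybe⁻ xs y∈
∈-mapMaybe⁻ {f = f} (x ∷ xs) y∈           | nothing = ∈-mapMaybe⁻ xs y∈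

unique-proj₂⇒≡ : ∀ {A B : Set} {xs : List (A × B)} {a a′ b} → Unique (map proj₂ xs) →
                 (a , b) ∈ xs → (a′ , b) ∈ xs → a ≡ a′
unique-proj₂⇒≡ _            (here refl) (here refl) = refl
unique-proj₂⇒≡ (b≢ ∷ _)     (here refl) (there p′)  = ⊥-elim (All.lookup b≢ (∈-map⁺ proj₂ p′) refl)
unique-proj₂⇒≡ (b≢ ∷ _)     (there p)   (here refl) = ⊥-elim (All.lookup b≢ (∈-map⁺ proj₂ p) refl)
unique-proj₂⇒≡ (_ ∷ unique) (there p)   (there p′)  = unique-proj₂⇒≡ unique p p′

deleteEdge⊆ : ∀ {n} (G : Adj n) {u w a b} → deleteEdge G u w a b ≡ true → G a b ≡ true
deleteEdge⊆ G {a = a} {b} h with G a b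
... | true = refl

deleteEdge-true : ∀ {n} (G : Adj n) {u w a b} → G a b ≡ true →
                  ¬ (a ≡ u × b ≡ w) → ¬ (a ≡ w × b ≡ u) → deleteEdge G u w a b ≡ true
deleteEdge-true G {u} {w} {a} {b} h ¬uw ¬wu rewrite h with a ≟ u | b ≟ w | a ≟ w | b ≟ u
... | yes a≡u | yes b≡w | _       | _       = ⊥-elim (¬uw (a≡u , b≡w))
... | _       | _       | yes a≡w | yes b≡u = ⊥-elim (¬wu (a≡w , b≡u))
... | no _    | _       | no _    | _       = refl
... | no _    | _       | yes _   | no _    = refl
... | yes _   | no _    | no _    | _       = refl
... | yes _   | no _    | yes _   | no _    = refl

deleteEdge-false : ∀ {n} (G : Adj n) {u w a b} → G a b ≡ true → deleteEdge G u w a b ≡ false →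
                   (a ≡ u × b ≡ w) ⊎ (a ≡ w × b ≡ u)
deleteEdge-false G {u} {w} {a} {b} h gone with a ≟ u ×-dec b ≟ w | a ≟ w ×-dec b ≟ u
... | yes uw | _      = inj₁ uw
... | no _   | yes wu = inj₂ wu
... | no ¬uw | no ¬wu with () ← trans (sym (deleteEdge-true G h ¬uw ¬wu)) gone

deleteEdge-row : ∀ {n} (G : Adj n) {u w} → u ≢ w → ∀ z → deleteEdge G u w u z ≡ without (G u) w z
deleteEdge-row G {u} {w} u≢w z with u ≟ u | u ≟ w
... | yes _  | no _    = cong (λ b → G u z ∧ not b) (∨-identityʳ ⌊ z ≟ w ⌋)
... | no u≢u | _       = ⊥-elim (u≢u refl)
... | yes _  | yes u≡w = ⊥-elim (u≢w u≡w)

deg-deleteEdge : ∀ {n} (G : Adj n) {u w} → G u w ≡ true → u ≢ w →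
                 deg G u ≡ suc (deg (deleteEdge G u w) u)
deg-deleteEdge G uw u≢w =
  trans (countTrue-without (G _) uw) (cong suc (sym (countTrue-cong (deleteEdge-row G u≢w))))

module _ {k n} {H : Adj n} (φ : TotalColoring k H) where
  open TotalColoring φ

  coloursAt : Fin n → List (Fin k)
  coloursAt a = vcol a ∷ map (ecol a) (trues (H a))

  length-coloursAt : ∀ a → length (coloursAt a) ≡ suc (deg H a)
  length-coloursAt a = cong suc (trans (length-map (ecol a) (trues (H a))) (length-trues (H a)))

  ∃-missingColour : ∀ a → suc (deg H a) < k →
                    ∃ λ c → c ≢ vcol a × (∀ z → H a z ≡ true → c ≢ ecol a z)
  ∃-missingColour a few with ∃-∉ (coloursAt a) (subst (_< k) (sym (length-coloursAt a)) few)
  ... | c , c∉ = c , (λ c≡ → c∉ (here c≡))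
                   , (λ z h c≡ → c∉ (there (subst (_∈ _) (sym c≡) (∈-map⁺ (ecol a) (∈-trues (H a) h)))))

  ecol-unique : ∀ {a zs} → Unique zs → All (λ z → H a z ≡ true) zs → Unique (map (ecol a) zs)
  ecol-unique [] [] = []
  ecol-unique {a} (z∉ ∷ unique) (hz ∷ hs) =
    All.map⁺ (All.zipWith (λ (z≢y , hy) → ee-proper a _ _ hz hy z≢y) (z∉ , hs)) ∷ ecol-unique unique hs

  ecol-admissible : ∀ {a z ys} → H a z ≡ true → z ∈ ys →
                    ecol a z ≢ vcol a × (∀ {b} → H a b ≡ true → b ∉ ys → ecol a z ≢ ecol a b)
  ecol-admissible {a} {z} hz z∈ =
    (λ eq → ve-proper a z hz (sym eq)) , (λ hb b∉ → ee-proper a z _ hz hb (λ { refl → b∉ z∈ }))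

-- A total colouring φ of a subgraph G′ of G is modified near the vertices τ 0, …, τ (m − 1):
-- the edge τr τs gets colour c when newEdge r s ≡ just c, the vertex τr gets colour c when
-- newVertex r ≡ just c, and all other vertices and edges keep their colours under φ.
module LocalRecolouring
  {n k m : ℕ} {G G′ : Adj n} (G-symm : ∀ a b → G a b ≡ G b a) (φ : TotalColoring k G′)
  (τ : Fin m → Fin n) (τ-injective : ∀ {r s} → τ r ≡ τ s → r ≡ s)
  (newEdge : Fin m → Fin m → Maybe (Fin k)) (newEdge-sym : ∀ r s → newEdge r s ≡ newEdge s r)
  (newVertex : Fin m → Maybe (Fin k))
  (deleted : ∀ {a b} → G a b ≡ true → G′ a b ≡ false →
             ∃₂ λ r s → a ≡ τ r × b ≡ τ s × newEdge r s ≢ nothing ×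
                        (newVertex r ≢ nothing ⊎ newVertex s ≢ nothing))
  where

  open TotalColoring φ

  data Position (a : Fin n) : Set where
    touched   : ∀ r → a ≡ τ r → Position a
    untouched : (∀ r → a ≢ τ r) → Position a

  position : ∀ a → Position a
  position a with any? (λ r → a ≟ τ r)
  ... | yes (r , a≡τr) = touched r a≡τr
  ... | no  ∄r         = untouched (λ r a≡τr → ∄r (r , a≡τr))

  vcol′ : ∀ {a} → Position a → Fin k
  vcol′ {a} (touched r _) = fromMaybe (vcol a) (newVertex r)
  vcol′ {a} (untouched _) = vcol a

  ecol′ : ∀ {a b} → Position a → Position b → Fin k
  ecol′ {a} {b} (touched r _) (touched s _) = fromMaybe (ecol a b) (newEdge r s)
  ecol′ {a} {b} _             _             = ecol a b

  star : Fin m → List (Fin n × Fin k)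
  star r = mapMaybe (λ s → Maybe.map (τ s ,_) (newEdge r s)) (allFin m)

  KeptAt : Fin m → Fin n → Set
  KeptAt r b = ∀ s → b ≡ τ s → newEdge r s ≡ nothing

  kept-touched : ∀ {r s} → newEdge r s ≡ nothing → KeptAt r (τ s)
  kept-touched {s = s} eq s′ τs≡τs′ with τ-injective {s} {s′} τs≡τs′
  ... | refl = eq

  kept-untouched : ∀ {r b} → (∀ s → b ≢ τ s) → KeptAt r b
  kept-untouched b-untouched s b≡τs = ⊥-elim (b-untouched s b≡τs)

  ∈-star⁺ : ∀ {r s c} → newEdge r s ≡ just c → (τ s , c) ∈ star r
  ∈-star⁺ {r} {s} eq = ∈-mapMaybe⁺ (∈-allFin s) (cong (Maybe.map (τ s ,_)) eq)

  ∈-star⁻ : ∀ {r b c} → (b , c) ∈ star r → ∃ λ s → b ≡ τ s × newEdge r s ≡ just c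
  ∈-star⁻ {r} b,c∈ with ∈-mapMaybe⁻ (allFin m) b,c∈
  ... | s , eq with newEdge r s in eq′ | eq
  ...   | just _ | refl = s , refl , eq′

  kept∉star : ∀ {r b} → KeptAt r b → b ∉ map proj₁ (star r)
  kept∉star kept b∈ with ∈-map⁻ proj₁ b∈
  ... | (b , c) , b,c∈ , refl with ∈-star⁻ b,c∈
  ...   | s , b≡τs , eq with () ← trans (sym (kept s b≡τs)) eq

  kept-edge : ∀ {r b} → G (τ r) b ≡ true → KeptAt r b → G′ (τ r) b ≡ true
  kept-edge {r} {b} h kept with G′ (τ r) b in eq
  ... | true  = refl
  ... | false with deleted h eq
  ...   | r′ , s , τr≡τr′ , b≡τs , recoloured , _ with τ-injective τr≡τr′
  ...     | refl = ⊥-elim (recoloured (kept s b≡τs))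

  untouched-edge : ∀ {a b} → (∀ r → a ≢ τ r) → G a b ≡ true → G′ a b ≡ true
  untouched-edge {a} {b} a-untouched h with G′ a b in eq
  ... | true  = refl
  ... | false with deleted h eq
  ...   | r , _ , a≡τr , _ = ⊥-elim (a-untouched r a≡τr)

  data Incidence (r : Fin m) (b : Fin n) (c : Fin k) : Set where
    changed : (b , c) ∈ star r → Incidence r b c
    kept    : b ∉ map proj₁ (star r) → G′ (τ r) b ≡ true → c ≡ ecol (τ r) b → Incidence r b c

  classify : ∀ {b} r (pb : Position b) → G (τ r) b ≡ true → Incidence r b (ecol′ (touched r refl) pb)
  classify r (touched s refl) h with newEdge r s in eq
  ... | just c  = changed (∈-star⁺ eq)
  ... | nothing = kept (kept∉star (kept-touched eq)) (kept-edge h (kept-touched eq)) refl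
  classify r (untouched b-untouched) h =
    kept (kept∉star (kept-untouched b-untouched)) (kept-edge h (kept-untouched b-untouched)) refl

  touchedVcol : Fin m → Fin k
  touchedVcol r = fromMaybe (vcol (τ r)) (newVertex r)

  record StarCondition (r : Fin m) : Set where
    field
      new-unique  : Unique (map proj₂ (star r))
      new≢kept    : ∀ {c b} → c ∈ map proj₂ (star r) → G′ (τ r) b ≡ true →
                    b ∉ map proj₁ (star r) → c ≢ ecol (τ r) b
      vertex∉new  : touchedVcol r ∉ map proj₂ (star r)
      vertex≢kept : ∀ {b} → G′ (τ r) b ≡ true → b ∉ map proj₁ (star r) → touchedVcol r ≢ ecol (τ r) b

  open StarCondition

  incidences-differ : ∀ {r b b′ c c′} → StarCondition r → Incidence r b c → Incidence r b′ c′ →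
                      b ≢ b′ → c ≢ c′
  incidences-differ {r} {b′ = b′} cond (changed b∈) (changed b′∈) b≢b′ eq =
    b≢b′ (unique-proj₂⇒≡ (new-unique cond) b∈ (subst (λ col → (b′ , col) ∈ star r) (sym eq) b′∈))
  incidences-differ cond (changed b∈) (kept b′∉ h′ eq′) _ eq =
    new≢kept cond (∈-map⁺ proj₂ b∈) h′ b′∉ (trans eq eq′)
  incidences-differ cond (kept b∉ h eq) (changed b′∈) _ eq′ =
    new≢kept cond (∈-map⁺ proj₂ b′∈) h b∉ (trans (sym eq′) eq)
  incidences-differ cond (kept _ h eq) (kept _ h′ eq′) b≢b′ eq″ =
    ee-proper _ _ _ h h′ b≢b′ (trans (sym eq) (trans eq″ eq′))

  touchedVcol≢incidence : ∀ {r b c} → StarCondition r → Incidence r b c → touchedVcol r ≢ c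
  touchedVcol≢incidence {r} cond (changed b∈) eq =
    vertex∉new cond (subst (_∈ map proj₂ (star r)) (sym eq) (∈-map⁺ proj₂ b∈))
  touchedVcol≢incidence cond (kept b∉ h eq′) eq = vertex≢kept cond h b∉ (trans eq eq′)

  Admissible : Fin m → Fin k → Set
  Admissible r o = o ≢ vcol (τ r) × (∀ {b} → G′ (τ r) b ≡ true → b ∉ map proj₁ (star r) → o ≢ ecol (τ r) b)

  permutedStar : ∀ r → newVertex r ≡ nothing → ∀ {olds} → map proj₂ (star r) ↭ olds → Unique olds →
                 (∀ {o} → o ∈ olds → Admissible r o) → StarCondition r
  permutedStar r stable new↭old unique-old admissible = record
    { new-unique  = Unique-resp-↭ (↭-sym new↭old) unique-old
    ; new≢kept    = λ c∈ → proj₂ (admissible (∈-resp-↭ new↭old c∈))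
    ; vertex∉new  = subst (_∉ map proj₂ (star r)) (sym touchedVcol≡)
                      λ v∈ → proj₁ (admissible (∈-resp-↭ new↭old v∈)) refl
    ; vertex≢kept = λ h _ → subst (_≢ ecol (τ r) _) (sym touchedVcol≡) (ve-proper _ _ h)
    }
    where
    touchedVcol≡ : touchedVcol r ≡ vcol (τ r)
    touchedVcol≡ = cong (fromMaybe (vcol (τ r))) stable

  FreshVertex : Fin m → Fin k → Set
  FreshVertex r c = ∀ b → G (τ r) b ≡ true → (∀ s → b ≡ τ s → newVertex s ≡ nothing) × c ≢ vcol b

  module _ (stars : ∀ r → StarCondition r)
           (fresh : ∀ r {c} → newVertex r ≡ just c → FreshVertex r c) where

    ecol′-sym : ∀ {a b} (pa : Position a) (pb : Position b) → G a b ≡ true → ecol′ pa pb ≡ ecol′ pb pa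
    ecol′-sym (touched r refl) (touched s refl) h rewrite newEdge-sym r s with newEdge s r in eq
    ... | just _  = refl
    ... | nothing = ecol-sym (τ r) (τ s) (kept-edge h (kept-touched (trans (newEdge-sym r s) eq)))
    ecol′-sym (touched r refl) (untouched b-untouched) h =
      sym (ecol-sym _ _ (untouched-edge b-untouched (trans (G-symm _ _) h)))
    ecol′-sym (untouched a-untouched) (touched s refl) h = ecol-sym _ _ (untouched-edge a-untouched h)
    ecol′-sym (untouched a-untouched) (untouched _)   h = ecol-sym _ _ (untouched-edge a-untouched h)

    ecol′-proper : ∀ {a b c} (pa : Position a) (pb : Position b) (pc : Position c) →
                   G a b ≡ true → G a c ≡ true → b ≢ c → ecol′ pa pb ≢ ecol′ pa pc
    ecol′-proper (touched r refl) pb pc hb hc =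
      incidences-differ (stars r) (classify r pb hb) (classify r pc hc)
    ecol′-proper (untouched a-untouched) _ _ hb hc =
      ee-proper _ _ _ (untouched-edge a-untouched hb) (untouched-edge a-untouched hc)

    vcol′≢ecol′ : ∀ {a b} (pa : Position a) (pb : Position b) → G a b ≡ true → vcol′ pa ≢ ecol′ pa pb
    vcol′≢ecol′ (touched r refl) pb h = touchedVcol≢incidence (stars r) (classify r pb h)
    vcol′≢ecol′ (untouched a-untouched) _ h = ve-proper _ _ (untouched-edge a-untouched h)

    stable-edge : ∀ {r s} → G (τ r) (τ s) ≡ true → newVertex r ≡ nothing → newVertex s ≡ nothing →
                  G′ (τ r) (τ s) ≡ true
    stable-edge {r} {s} h r-stable s-stable with G′ (τ r) (τ s) in eq
    ... | true  = refl
    ... | false with deleted h eq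
    ...   | r′ , s′ , τr≡τr′ , τs≡τs′ , _ , fresh-end with τ-injective τr≡τr′ | τ-injective τs≡τs′ | fresh-end
    ...     | refl | refl | inj₁ r-fresh = ⊥-elim (r-fresh r-stable)
    ...     | refl | refl | inj₂ s-fresh = ⊥-elim (s-fresh s-stable)

    vcol′-proper : ∀ {a b} (pa : Position a) (pb : Position b) → G a b ≡ true → vcol′ pa ≢ vcol′ pb
    vcol′-proper (touched r refl) (touched s refl) h with newVertex r in er | newVertex s in es
    ... | just _  | just _  with () ← trans (sym es) (proj₁ (fresh r er (τ s) h) s refl)
    ... | just _  | nothing = proj₂ (fresh r er (τ s) h)
    ... | nothing | just _  = ≢-sym (proj₂ (fresh s es (τ r) (trans (G-symm _ _) h)))
    ... | nothing | nothing = vv-proper _ _ (stable-edge h er es)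
    vcol′-proper (touched r refl) (untouched b-untouched) h with newVertex r in er
    ... | just _  = proj₂ (fresh r er _ h)
    ... | nothing = ≢-sym (vv-proper _ _ (untouched-edge b-untouched (trans (G-symm _ _) h)))
    vcol′-proper (untouched a-untouched) (touched s refl) h with newVertex s in es
    ... | just _  = ≢-sym (proj₂ (fresh s es _ (trans (G-symm _ _) h)))
    ... | nothing = vv-proper _ _ (untouched-edge a-untouched h)
    vcol′-proper (untouched a-untouched) (untouched _) h = vv-proper _ _ (untouched-edge a-untouched h)

    totalColouring : TotalColoring k G
    totalColouring = record
      { vcol      = λ a → vcol′ (position a)
      ; ecol      = λ a b → ecol′ (position a) (position b)
      ; ecol-sym  = λ a b → ecol′-sym (position a) (position b)
      ; vv-proper = λ a b → vcol′-proper (position a) (position b)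
      ; ee-proper = λ a b c → ecol′-proper (position a) (position b) (position c)
      ; ve-proper = λ a b → vcol′≢ecol′ (position a) (position b)
      }

-- The colours of G − vw₄ around v: aᵢ is the colour of vwᵢ, α a colour missing at v, cᵢⱼ the
-- colour of wᵢwⱼ, and c₄ₓ, c₅ₓ those of w₄x, w₅x.
record OldColours {A : Set} (a₁ a₂ a₃ a₅ α c₁₂ c₂₃ c₃₄ c₄ₓ c₅ₓ c₅₆ : A) : Set where
  constructor oldColours
  field
    at-v  : Unique (a₁ ∷ a₂ ∷ a₃ ∷ α ∷ a₅ ∷ [])
    at-w₁ : a₁ ≢ c₁₂
    at-w₂ : Unique (a₂ ∷ c₁₂ ∷ c₂₃ ∷ [])
    at-w₃ : Unique (a₃ ∷ c₂₃ ∷ c₃₄ ∷ [])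
    at-w₄ : c₃₄ ≢ c₄ₓ
    at-w₅ : Unique (a₅ ∷ c₅ₓ ∷ c₅₆ ∷ [])

-- New colours Aᵢ for vwᵢ (now including vw₄) and Cᵢⱼ for wᵢwⱼ.  At v, w₁, w₃ they permute the
-- old colours; w₂, w₄, w₅ get fresh vertex colours later, so there distinctness suffices.
record Recolouring {A : Set} (a₁ a₂ a₃ a₅ α c₁₂ c₂₃ c₃₄ c₄ₓ c₅ₓ c₅₆ : A) : Set where
  constructor recoloured
  field
    A₁ A₂ A₃ A₄ A₅ C₁₂ C₂₃ C₃₄ : A
    at-v  : A₁ ∷ A₂ ∷ A₃ ∷ A₄ ∷ A₅ ∷ [] ↭ a₁ ∷ a₂ ∷ a₃ ∷ α ∷ a₅ ∷ []
    at-w₁ : A₁ ∷ C₁₂ ∷ [] ↭ a₁ ∷ c₁₂ ∷ []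
    at-w₃ : A₃ ∷ C₂₃ ∷ C₃₄ ∷ [] ↭ a₃ ∷ c₂₃ ∷ c₃₄ ∷ []
    at-w₂ : Unique (A₂ ∷ C₁₂ ∷ C₂₃ ∷ [])
    at-w₄ : Unique (A₄ ∷ C₃₄ ∷ c₄ₓ ∷ [])
    at-w₅ : Unique (A₅ ∷ c₅ₓ ∷ c₅₆ ∷ [])

module _ {A : Set} (_≟_ : DecidableEquality A) where

  one-of-two-avoids : ∀ {s s′ y z : A} → s ≢ s′ → s ≢ y → s ≢ z → y ≢ z →
                      (y ≢ s × y ≢ s′) ⊎ (z ≢ s × z ≢ s′)
  one-of-two-avoids {s} {s′} {y} s≢s′ s≢y s≢z y≢z with y ≟ s′
  ... | no y≢s′ = inj₁ (≢-sym s≢y , y≢s′)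
  ... | yes refl = inj₂ (≢-sym s≢z , ≢-sym y≢z)

  one-of-three-avoids : ∀ {t u x y z : A} → t ≢ u → Unique (x ∷ y ∷ z ∷ []) →
                        (x ≢ t × x ≢ u) ⊎ (y ≢ t × y ≢ u) ⊎ (z ≢ t × z ≢ u)
  one-of-three-avoids {t} {u} {x} t≢u ((x≢y ∷ x≢z ∷ []) ∷ (y≢z ∷ []) ∷ [] ∷ [])
    with x ≟ t | x ≟ u
  ... | no x≢t | no x≢u  = inj₁ (x≢t , x≢u)
  ... | yes refl | _     = inj₂ (one-of-two-avoids t≢u x≢y x≢z y≢z)
  ... | no _ | yes refl  =
    inj₂ (Sum.map Product.swap Product.swap (one-of-two-avoids (≢-sym t≢u) x≢y x≢z y≢z))

  recolour-α≡c₃₄-a₂≡c₄ₓ : ∀ {a₁ a₂ a₃ a₅ α c₁₂ c₂₃ c₃₄ c₄ₓ c₅ₓ c₅₆} → α ≡ c₃₄ → a₂ ≡ c₄ₓ →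
    OldColours a₁ a₂ a₃ a₅ α c₁₂ c₂₃ c₃₄ c₄ₓ c₅ₓ c₅₆ → Recolouring a₁ a₂ a₃ a₅ α c₁₂ c₂₃ c₃₄ c₄ₓ c₅ₓ c₅₆
  recolour-α≡c₃₄-a₂≡c₄ₓ {a₁} {a₂} {a₃} {a₅} {α} {c₁₂} {c₂₃} {c₃₄} {c₄ₓ} {c₅ₓ} {c₅₆} refl refl
    (oldColours (_ ∷ (a₂≢a₃ ∷ a₂≢α ∷ _ ∷ []) ∷ (a₃≢α ∷ _ ∷ []) ∷ _ ∷ [] ∷ [])
                  _
                  ((a₂≢c₁₂ ∷ a₂≢c₂₃ ∷ []) ∷ _ ∷ [] ∷ [])
                  ((a₃≢c₂₃ ∷ _ ∷ []) ∷ (c₂₃≢c₃₄ ∷ []) ∷ [] ∷ [])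
                  _
                  ((a₅≢c₅ₓ ∷ a₅≢c₅₆ ∷ []) ∷ (c₅ₓ≢c₅₆ ∷ []) ∷ [] ∷ [])) with a₃ ≟ c₁₂
  ... | yes refl = recoloured a₁ a₂ a₃ α a₅ c₁₂ c₃₄ c₂₃
        refl refl (prep _ (swap _ _ refl))
        (distinct₃ a₂≢a₃ a₂≢α a₃≢α) (distinct₃ (≢-sym c₂₃≢c₃₄) (≢-sym a₂≢α) (≢-sym a₂≢c₂₃))
        (distinct₃ a₅≢c₅ₓ a₅≢c₅₆ c₅ₓ≢c₅₆)
  ... | no a₃≢c₁₂ = recoloured a₁ a₂ c₃₄ a₃ a₅ c₁₂ a₃ c₂₃
        (prep _ (prep _ (swap _ _ refl))) refl (↭-trans (shift _ (c₃₄ ∷ []) _) (prep _ (swap _ _ refl)))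
        (distinct₃ a₂≢c₁₂ a₂≢a₃ (≢-sym a₃≢c₁₂)) (distinct₃ a₃≢c₂₃ (≢-sym a₂≢a₃) (≢-sym a₂≢c₂₃))
        (distinct₃ a₅≢c₅ₓ a₅≢c₅₆ c₅ₓ≢c₅₆)

  recolour-α≡c₃₄ : ∀ {a₁ a₂ a₃ a₅ α c₁₂ c₂₃ c₃₄ c₄ₓ c₅ₓ c₅₆} → α ≡ c₃₄ →
    OldColours a₁ a₂ a₃ a₅ α c₁₂ c₂₃ c₃₄ c₄ₓ c₅ₓ c₅₆ → Recolouring a₁ a₂ a₃ a₅ α c₁₂ c₂₃ c₃₄ c₄ₓ c₅ₓ c₅₆
  recolour-α≡c₃₄ {a₁} {a₂} {a₃} {a₅} {α} {c₁₂} {c₂₃} {c₃₄} {c₄ₓ} {c₅ₓ} {c₅₆} refl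
    old@(oldColours ((a₁≢a₂ ∷ a₁≢a₃ ∷ a₁≢α ∷ a₁≢a₅ ∷ []) ∷ (a₂≢a₃ ∷ a₂≢α ∷ _ ∷ []) ∷
                     (a₃≢α ∷ a₃≢a₅ ∷ []) ∷ (α≢a₅ ∷ []) ∷ [] ∷ [])
                      _
                      ((_ ∷ a₂≢c₂₃ ∷ []) ∷ (c₁₂≢c₂₃ ∷ []) ∷ [] ∷ [])
                      ((a₃≢c₂₃ ∷ _ ∷ []) ∷ (c₂₃≢c₃₄ ∷ []) ∷ [] ∷ [])
                      c₃₄≢c₄ₓ
                      ((a₅≢c₅ₓ ∷ a₅≢c₅₆ ∷ []) ∷ (c₅ₓ≢c₅₆ ∷ []) ∷ [] ∷ [])) with a₂ ≟ c₄ₓ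
  ... | yes refl = recolour-α≡c₃₄-a₂≡c₄ₓ refl refl old
  ... | no a₂≢c₄ₓ with α ≟ c₁₂
  ...   | no α≢c₁₂ = recoloured a₁ α a₃ a₂ a₅ c₁₂ c₂₃ c₃₄
          (prep _ (↭-trans (shift _ (α ∷ a₃ ∷ []) _) (prep _ (swap _ _ refl)))) refl refl
          (distinct₃ α≢c₁₂ (≢-sym c₂₃≢c₃₄) c₁₂≢c₂₃) (distinct₃ a₂≢α a₂≢c₄ₓ c₃₄≢c₄ₓ)
          (distinct₃ a₅≢c₅ₓ a₅≢c₅₆ c₅ₓ≢c₅₆)
  ...   | yes refl with a₃ ≟ c₄ₓ
  ...     | no a₃≢c₄ₓ = recoloured a₁ a₃ c₃₄ a₂ a₅ c₁₂ c₂₃ a₃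
            (prep _ (shift _ (a₃ ∷ c₃₄ ∷ []) _)) refl
            (↭-trans (shift _ (c₃₄ ∷ c₂₃ ∷ []) _) (prep _ (swap _ _ refl)))
            (distinct₃ a₃≢α a₃≢c₂₃ c₁₂≢c₂₃) (distinct₃ a₂≢a₃ a₂≢c₄ₓ a₃≢c₄ₓ)
            (distinct₃ a₅≢c₅ₓ a₅≢c₅₆ c₅ₓ≢c₅₆)
  ...     | yes refl with a₁ ≟ c₂₃
  ...       | no a₁≢c₂₃ = recoloured c₁₂ a₂ a₃ a₁ a₅ a₁ c₂₃ c₃₄
              (↭-trans (shift _ (c₁₂ ∷ a₂ ∷ a₃ ∷ []) _) (prep _ (↭-trans (shift _ (c₁₂ ∷ []) _) (prep _ (swap _ _ refl)))))
              (swap _ _ refl) refl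
              (distinct₃ (≢-sym a₁≢a₂) a₂≢c₂₃ a₁≢c₂₃) (distinct₃ a₁≢α a₁≢a₃ (≢-sym a₃≢α))
              (distinct₃ a₅≢c₅ₓ a₅≢c₅₆ c₅ₓ≢c₅₆)
  ...       | yes refl with one-of-three-avoids c₅ₓ≢c₅₆ (distinct₃ (≢-sym a₃≢α) (≢-sym a₁≢α) (≢-sym a₁≢a₃))
  ...         | inj₁ (α≢c₅ₓ , α≢c₅₆) = recoloured a₁ a₂ a₃ a₅ α c₁₂ c₂₃ c₃₄
                (prep _ (prep _ (prep _ (swap _ _ refl)))) refl refl
                (distinct₃ a₂≢α (≢-sym a₁≢a₂) (≢-sym a₁≢α)) (distinct₃ (≢-sym α≢a₅) (≢-sym a₃≢a₅) (≢-sym a₃≢α))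
                (distinct₃ α≢c₅ₓ α≢c₅₆ c₅ₓ≢c₅₆)
  ...         | inj₂ (inj₁ (a₃≢c₅ₓ , a₃≢c₅₆)) = recoloured a₁ a₂ c₃₄ a₅ a₃ c₁₂ a₃ c₂₃
                (prep _ (prep _ (shift _ (c₃₄ ∷ a₅ ∷ []) _))) refl
                (↭-trans (shift _ (c₃₄ ∷ []) _) (prep _ (swap _ _ refl)))
                (distinct₃ a₂≢α a₂≢a₃ (≢-sym a₃≢α)) (distinct₃ (≢-sym a₁≢a₅) (≢-sym a₃≢a₅) a₁≢a₃)
                (distinct₃ a₃≢c₅ₓ a₃≢c₅₆ c₅ₓ≢c₅₆)
  ...         | inj₂ (inj₂ (a₁≢c₅ₓ , a₁≢c₅₆)) = recoloured c₁₂ a₂ a₃ a₅ a₁ a₁ c₃₄ c₂₃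
                (↭-trans (shift _ (c₁₂ ∷ a₂ ∷ a₃ ∷ a₅ ∷ []) _) (prep _ (↭-trans (shift _ (c₁₂ ∷ []) _) (prep _ (swap _ _ refl)))))
                (swap _ _ refl) (prep _ (swap _ _ refl))
                (distinct₃ (≢-sym a₁≢a₂) a₂≢α a₁≢α) (distinct₃ (≢-sym a₁≢a₅) (≢-sym a₃≢a₅) a₁≢a₃)
                (distinct₃ a₁≢c₅ₓ a₁≢c₅₆ c₅ₓ≢c₅₆)

  recolour-α≡c₄ₓ≡c₁₂ : ∀ {a₁ a₂ a₃ a₅ α c₁₂ c₂₃ c₃₄ c₄ₓ c₅ₓ c₅₆} → α ≡ c₄ₓ → α ≡ c₁₂ →
    OldColours a₁ a₂ a₃ a₅ α c₁₂ c₂₃ c₃₄ c₄ₓ c₅ₓ c₅₆ → Recolouring a₁ a₂ a₃ a₅ α c₁₂ c₂₃ c₃₄ c₄ₓ c₅ₓ c₅₆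
  recolour-α≡c₄ₓ≡c₁₂ {a₁} {a₂} {a₃} {a₅} {α} {c₁₂} {c₂₃} {c₃₄} {c₄ₓ} {c₅ₓ} {c₅₆} refl refl
    (oldColours ((a₁≢a₂ ∷ a₁≢a₃ ∷ a₁≢α ∷ _ ∷ []) ∷ (a₂≢a₃ ∷ _ ∷ _ ∷ []) ∷ (a₃≢α ∷ _ ∷ []) ∷ _ ∷ [] ∷ [])
                  _
                  ((_ ∷ a₂≢c₂₃ ∷ []) ∷ (c₁₂≢c₂₃ ∷ []) ∷ [] ∷ [])
                  ((a₃≢c₂₃ ∷ a₃≢c₃₄ ∷ []) ∷ _ ∷ [] ∷ [])
                  c₃₄≢c₄ₓ
                  ((a₅≢c₅ₓ ∷ a₅≢c₅₆ ∷ []) ∷ (c₅ₓ≢c₅₆ ∷ []) ∷ [] ∷ [])) with a₁ ≟ c₂₃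
  ... | yes refl = recoloured c₁₂ a₂ c₂₃ a₃ a₅ a₁ a₃ c₃₄
        (↭-trans (shift _ (c₁₂ ∷ a₂ ∷ []) _) (prep _ (↭-trans (shift _ (c₁₂ ∷ []) _) (prep _ (swap _ _ refl)))))
        (swap _ _ refl) (swap _ _ refl)
        (distinct₃ (≢-sym a₁≢a₂) a₂≢a₃ a₁≢a₃) (distinct₃ a₃≢c₃₄ a₃≢α c₃₄≢c₄ₓ)
        (distinct₃ a₅≢c₅ₓ a₅≢c₅₆ c₅ₓ≢c₅₆)
  ... | no a₁≢c₂₃ with a₁ ≟ c₃₄
  ...   | yes refl = recoloured c₁₂ a₂ c₃₄ a₃ a₅ a₁ a₃ c₂₃
          (↭-trans (shift _ (c₁₂ ∷ a₂ ∷ []) _) (prep _ (↭-trans (shift _ (c₁₂ ∷ []) _) (prep _ (swap _ _ refl)))))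
          (swap _ _ refl) (↭-trans (shift _ (c₃₄ ∷ []) _) (prep _ (swap _ _ refl)))
          (distinct₃ (≢-sym a₁≢a₂) a₂≢a₃ a₁≢a₃) (distinct₃ a₃≢c₂₃ a₃≢α (≢-sym c₁₂≢c₂₃))
          (distinct₃ a₅≢c₅ₓ a₅≢c₅₆ c₅ₓ≢c₅₆)
  ...   | no a₁≢c₃₄ = recoloured c₁₂ a₂ a₃ a₁ a₅ a₁ c₂₃ c₃₄
          (↭-trans (shift _ (c₁₂ ∷ a₂ ∷ a₃ ∷ []) _) (prep _ (↭-trans (shift _ (c₁₂ ∷ []) _) (prep _ (swap _ _ refl)))))
          (swap _ _ refl) refl
          (distinct₃ (≢-sym a₁≢a₂) a₂≢c₂₃ a₁≢c₂₃) (distinct₃ a₁≢c₃₄ a₁≢α c₃₄≢c₄ₓ)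
          (distinct₃ a₅≢c₅ₓ a₅≢c₅₆ c₅ₓ≢c₅₆)

  recolour-α≡c₄ₓ-α∉c₁₂c₂₃ : ∀ {a₁ a₂ a₃ a₅ α c₁₂ c₂₃ c₃₄ c₄ₓ c₅ₓ c₅₆} → α ≡ c₄ₓ → α ≢ c₁₂ → α ≢ c₂₃ →
    OldColours a₁ a₂ a₃ a₅ α c₁₂ c₂₃ c₃₄ c₄ₓ c₅ₓ c₅₆ → Recolouring a₁ a₂ a₃ a₅ α c₁₂ c₂₃ c₃₄ c₄ₓ c₅ₓ c₅₆
  recolour-α≡c₄ₓ-α∉c₁₂c₂₃ {a₁} {a₂} {a₃} {a₅} {α} {c₁₂} {c₂₃} {c₃₄} {c₄ₓ} {c₅ₓ} {c₅₆} refl α≢c₁₂ α≢c₂₃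
    (oldColours (_ ∷ (_ ∷ a₂≢α ∷ _ ∷ []) ∷ _ ∷ _ ∷ [] ∷ [])
                  _
                  ((a₂≢c₁₂ ∷ a₂≢c₂₃ ∷ []) ∷ (c₁₂≢c₂₃ ∷ []) ∷ [] ∷ [])
                  _
                  c₃₄≢c₄ₓ
                  ((a₅≢c₅ₓ ∷ a₅≢c₅₆ ∷ []) ∷ (c₅ₓ≢c₅₆ ∷ []) ∷ [] ∷ [])) with a₂ ≟ c₃₄
  ... | yes refl = recoloured a₁ α a₃ a₂ a₅ c₁₂ c₃₄ c₂₃
        (prep _ (↭-trans (shift _ (α ∷ a₃ ∷ []) _) (prep _ (swap _ _ refl)))) refl
        (prep _ (swap _ _ refl))
        (distinct₃ α≢c₁₂ (≢-sym a₂≢α) (≢-sym a₂≢c₁₂)) (distinct₃ a₂≢c₂₃ a₂≢α (≢-sym α≢c₂₃))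
        (distinct₃ a₅≢c₅ₓ a₅≢c₅₆ c₅ₓ≢c₅₆)
  ... | no a₂≢c₃₄ = recoloured a₁ α a₃ a₂ a₅ c₁₂ c₂₃ c₃₄
        (prep _ (↭-trans (shift _ (α ∷ a₃ ∷ []) _) (prep _ (swap _ _ refl)))) refl refl
        (distinct₃ α≢c₁₂ α≢c₂₃ c₁₂≢c₂₃) (distinct₃ a₂≢c₃₄ a₂≢α c₃₄≢c₄ₓ)
        (distinct₃ a₅≢c₅ₓ a₅≢c₅₆ c₅ₓ≢c₅₆)

  recolour-α≡c₄ₓ : ∀ {a₁ a₂ a₃ a₅ α c₁₂ c₂₃ c₃₄ c₄ₓ c₅ₓ c₅₆} → α ≡ c₄ₓ →
    OldColours a₁ a₂ a₃ a₅ α c₁₂ c₂₃ c₃₄ c₄ₓ c₅ₓ c₅₆ → Recolouring a₁ a₂ a₃ a₅ α c₁₂ c₂₃ c₃₄ c₄ₓ c₅ₓ c₅₆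
  recolour-α≡c₄ₓ {a₁} {a₂} {a₃} {a₅} {α} {c₁₂} {c₂₃} {c₃₄} {c₄ₓ} {c₅ₓ} {c₅₆} refl
    old@(oldColours ((a₁≢a₂ ∷ a₁≢a₃ ∷ a₁≢α ∷ a₁≢a₅ ∷ []) ∷ (a₂≢a₃ ∷ a₂≢α ∷ _ ∷ []) ∷
                     (a₃≢α ∷ a₃≢a₅ ∷ []) ∷ (α≢a₅ ∷ []) ∷ [] ∷ [])
                      _
                      ((a₂≢c₁₂ ∷ _ ∷ []) ∷ _ ∷ [] ∷ [])
                      ((_ ∷ a₃≢c₃₄ ∷ []) ∷ (c₂₃≢c₃₄ ∷ []) ∷ [] ∷ [])
                      _
                      ((a₅≢c₅ₓ ∷ a₅≢c₅₆ ∷ []) ∷ (c₅ₓ≢c₅₆ ∷ []) ∷ [] ∷ [])) with α ≟ c₁₂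
  ... | yes refl = recolour-α≡c₄ₓ≡c₁₂ refl refl old
  ... | no α≢c₁₂ with α ≟ c₂₃
  ...   | no α≢c₂₃ = recolour-α≡c₄ₓ-α∉c₁₂c₂₃ refl α≢c₁₂ α≢c₂₃ old
  ...   | yes refl with a₃ ≟ c₁₂
  ...     | no a₃≢c₁₂ = recoloured a₁ a₂ c₂₃ a₃ a₅ c₁₂ a₃ c₃₄
            (prep _ (prep _ (swap _ _ refl))) refl (swap _ _ refl)
            (distinct₃ a₂≢c₁₂ a₂≢a₃ (≢-sym a₃≢c₁₂)) (distinct₃ a₃≢c₃₄ a₃≢α (≢-sym c₂₃≢c₃₄))
            (distinct₃ a₅≢c₅ₓ a₅≢c₅₆ c₅ₓ≢c₅₆)
  ...     | yes refl with a₁ ≟ c₃₄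
  ...       | no a₁≢c₃₄ = recoloured c₁₂ a₂ c₂₃ a₁ a₅ a₁ a₃ c₃₄
              (↭-trans (shift _ (c₁₂ ∷ a₂ ∷ c₂₃ ∷ []) _) (prep _ (swap _ _ refl))) (swap _ _ refl)
              (swap _ _ refl)
              (distinct₃ (≢-sym a₁≢a₂) a₂≢a₃ a₁≢a₃) (distinct₃ a₁≢c₃₄ a₁≢α (≢-sym c₂₃≢c₃₄))
              (distinct₃ a₅≢c₅ₓ a₅≢c₅₆ c₅ₓ≢c₅₆)
  ...       | yes refl with one-of-three-avoids c₅ₓ≢c₅₆ (distinct₃ (≢-sym a₃≢α) (≢-sym a₁≢α) (≢-sym a₁≢a₃))
  ...         | inj₁ (α≢c₅ₓ , α≢c₅₆) = recoloured a₁ a₂ a₃ a₅ α c₁₂ c₂₃ c₃₄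
                (prep _ (prep _ (prep _ (swap _ _ refl)))) refl refl
                (distinct₃ a₂≢a₃ a₂≢α a₃≢α) (distinct₃ (≢-sym a₁≢a₅) (≢-sym α≢a₅) a₁≢α)
                (distinct₃ α≢c₅ₓ α≢c₅₆ c₅ₓ≢c₅₆)
  ...         | inj₂ (inj₁ (a₃≢c₅ₓ , a₃≢c₅₆)) = recoloured a₁ a₂ c₂₃ a₅ a₃ c₁₂ c₃₄ a₃
                (prep _ (prep _ (shift _ (c₂₃ ∷ a₅ ∷ []) _))) refl (shift _ (c₂₃ ∷ c₃₄ ∷ []) _)
                (distinct₃ a₂≢a₃ (≢-sym a₁≢a₂) (≢-sym a₁≢a₃)) (distinct₃ (≢-sym a₃≢a₅) (≢-sym α≢a₅) a₃≢α)
                (distinct₃ a₃≢c₅ₓ a₃≢c₅₆ c₅ₓ≢c₅₆)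
  ...         | inj₂ (inj₂ (a₁≢c₅ₓ , a₁≢c₅₆)) = recoloured c₁₂ a₂ c₂₃ a₅ a₁ a₁ a₃ c₃₄
                (↭-trans (shift _ (c₁₂ ∷ a₂ ∷ c₂₃ ∷ a₅ ∷ []) _) (prep _ (swap _ _ refl))) (swap _ _ refl)
                (swap _ _ refl)
                (distinct₃ (≢-sym a₁≢a₂) a₂≢a₃ a₁≢a₃) (distinct₃ (≢-sym a₁≢a₅) (≢-sym α≢a₅) a₁≢α)
                (distinct₃ a₁≢c₅ₓ a₁≢c₅₆ c₅ₓ≢c₅₆)

  -- α goes to vw₄ unless it is one of the colours c₃₄, c₄ₓ next to vw₄.  Otherwise colours are
  -- exchanged around the triangles vw₁w₂, vw₂w₃, vw₃w₄; in the deepest cases one of α, a₃, a₁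
  -- moves to vw₅, which works because at most two of them meet c₅ₓ and c₅₆.
  recolour : ∀ {a₁ a₂ a₃ a₅ α c₁₂ c₂₃ c₃₄ c₄ₓ c₅ₓ c₅₆} →
    OldColours a₁ a₂ a₃ a₅ α c₁₂ c₂₃ c₃₄ c₄ₓ c₅ₓ c₅₆ → Recolouring a₁ a₂ a₃ a₅ α c₁₂ c₂₃ c₃₄ c₄ₓ c₅ₓ c₅₆
  recolour {a₁} {a₂} {a₃} {a₅} {α} {c₁₂} {c₂₃} {c₃₄} {c₄ₓ} old with α ≟ c₃₄ | α ≟ c₄ₓ
  ... | yes α≡c₃₄ | _        = recolour-α≡c₃₄ α≡c₃₄ old
  ... | no _      | yes α≡c₄ₓ = recolour-α≡c₄ₓ α≡c₄ₓ old
  ... | no α≢c₃₄  | no α≢c₄ₓ  = recoloured a₁ a₂ a₃ α a₅ c₁₂ c₂₃ c₃₄ refl refl refl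
    (OldColours.at-w₂ old) (distinct₃ α≢c₃₄ α≢c₄ₓ (OldColours.at-w₄ old)) (OldColours.at-w₅ old)

record Figure6a {n} (G : Adj n) : Set where
  field
    v w₁ w₂ w₃ w₄ w₅ w₆ x : Fin n
    core-unique : Unique (v ∷ w₁ ∷ w₂ ∷ w₃ ∷ w₄ ∷ w₅ ∷ [])
    w₆∉core     : w₆ ∉ v ∷ w₁ ∷ w₂ ∷ w₃ ∷ w₄ ∷ w₅ ∷ []
    x∉core      : x ∉ v ∷ w₁ ∷ w₂ ∷ w₃ ∷ w₄ ∷ w₅ ∷ []
    w₆≢x        : w₆ ≢ x
    deg-v       : deg G v ≡ 8
    v∼w₁  : G v w₁ ≡ true
    v∼w₂  : G v w₂ ≡ true
    v∼w₃  : G v w₃ ≡ true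
    v∼w₄  : G v w₄ ≡ true
    v∼w₅  : G v w₅ ≡ true
    w₁∼w₂ : G w₁ w₂ ≡ true
    w₂∼w₃ : G w₂ w₃ ≡ true
    w₃∼w₄ : G w₃ w₄ ≡ true
    w₄∼x  : G w₄ x ≡ true
    w₅∼x  : G w₅ x ≡ true
    w₅∼w₆ : G w₅ w₆ ≡ true
    N-w₂  : ∀ {z} → G w₂ z ≡ true → z ∈ v ∷ w₁ ∷ w₃ ∷ []
    N-w₄  : ∀ {z} → G w₄ z ≡ true → z ∈ v ∷ w₃ ∷ x ∷ []
    N-w₅  : ∀ {z} → G w₅ z ≡ true → z ∈ v ∷ x ∷ w₆ ∷ []

adjacent⇒≢ : ∀ {n} {G : Adj n} → IsSimple G → ∀ {a b} → G a b ≡ true → a ≢ b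
adjacent⇒≢ simple {a} h refl with () ← trans (sym h) (IsSimple.irrefl simple a)

non-neighbour⇒≢ : ∀ {n} {G : Adj n} {v x y} → G v y ≡ true → G v x ≡ false → x ≢ y
non-neighbour⇒≢ v∼y v≁x refl with () ← trans (sym v∼y) v≁x

figure6a : ∀ {n} {G : Adj n} → IsSimple G → Config G → Figure6a G
figure6a {G = G} simple
  (v , w₁ , w₂ , w₃ , w₄ , w₅ , w₆ , x , deg-v ,
   ((w₁≢w₂ ∷ w₁≢w₃ ∷ w₁≢w₄ ∷ w₁≢w₅ ∷ w₁≢w₆ ∷ []) ∷ (w₂≢w₃ ∷ w₂≢w₄ ∷ w₂≢w₅ ∷ w₂≢w₆ ∷ []) ∷
    (w₃≢w₄ ∷ w₃≢w₅ ∷ w₃≢w₆ ∷ []) ∷ (w₄≢w₅ ∷ w₄≢w₆ ∷ []) ∷ (w₅≢w₆ ∷ []) ∷ [] ∷ []) ,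
   (v∼w₁ , v∼w₂ , v∼w₃ , v∼w₄ , v∼w₅ , v∼w₆) , (x≢v , v≁x) ,
   (w₁∼w₂ , w₂∼w₃ , w₃∼w₄ , w₅∼w₆ , x∼w₄ , x∼w₅) , (deg-w₂ , deg-w₄ , deg-w₅)) = record
  { v = v ; w₁ = w₁ ; w₂ = w₂ ; w₃ = w₃ ; w₄ = w₄ ; w₅ = w₅ ; w₆ = w₆ ; x = x
  ; core-unique = (adj≢ v∼w₁ ∷ adj≢ v∼w₂ ∷ adj≢ v∼w₃ ∷ adj≢ v∼w₄ ∷ adj≢ v∼w₅ ∷ []) ∷
                  (w₁≢w₂ ∷ w₁≢w₃ ∷ w₁≢w₄ ∷ w₁≢w₅ ∷ []) ∷ (w₂≢w₃ ∷ w₂≢w₄ ∷ w₂≢w₅ ∷ []) ∷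
                  (w₃≢w₄ ∷ w₃≢w₅ ∷ []) ∷ (w₄≢w₅ ∷ []) ∷ [] ∷ []
  ; w₆∉core = All¬⇒¬Any (≢-sym (adj≢ v∼w₆) ∷ ≢-sym w₁≢w₆ ∷ ≢-sym w₂≢w₆ ∷ ≢-sym w₃≢w₆ ∷
                          ≢-sym w₄≢w₆ ∷ ≢-sym w₅≢w₆ ∷ [])
  ; x∉core  = All¬⇒¬Any (x≢v ∷ x≢nbr v∼w₁ ∷ x≢nbr v∼w₂ ∷ x≢nbr v∼w₃ ∷ x≢nbr v∼w₄ ∷ x≢nbr v∼w₅ ∷ [])
  ; w₆≢x    = ≢-sym (x≢nbr v∼w₆)
  ; deg-v   = deg-v
  ; v∼w₁ = v∼w₁ ; v∼w₂ = v∼w₂ ; v∼w₃ = v∼w₃ ; v∼w₄ = v∼w₄ ; v∼w₅ = v∼w₅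
  ; w₁∼w₂ = w₁∼w₂ ; w₂∼w₃ = w₂∼w₃ ; w₃∼w₄ = w₃∼w₄
  ; w₄∼x  = G-sym x∼w₄ ; w₅∼x = G-sym x∼w₅ ; w₅∼w₆ = w₅∼w₆
  ; N-w₂ = countTrue-exhausted deg-w₂ (distinct₃ (adj≢ v∼w₁) (adj≢ v∼w₃) w₁≢w₃)
                                (G-sym v∼w₂ ∷ G-sym w₁∼w₂ ∷ w₂∼w₃ ∷ [])
  ; N-w₄ = countTrue-exhausted deg-w₄ (distinct₃ (adj≢ v∼w₃) (≢-sym x≢v) (≢-sym (x≢nbr v∼w₃)))
                                (G-sym v∼w₄ ∷ G-sym w₃∼w₄ ∷ G-sym x∼w₄ ∷ [])
  ; N-w₅ = countTrue-exhausted deg-w₅ (distinct₃ (≢-sym x≢v) (adj≢ v∼w₆) (x≢nbr v∼w₆))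
                                (G-sym v∼w₅ ∷ G-sym x∼w₅ ∷ w₅∼w₆ ∷ [])
  }
  where
  adj≢ : ∀ {a b} → G a b ≡ true → a ≢ b
  adj≢ = adjacent⇒≢ simple
  x≢nbr : ∀ {y} → G v y ≡ true → x ≢ y
  x≢nbr v∼y = non-neighbour⇒≢ {G = G} v∼y v≁x
  G-sym : ∀ {a b} → G a b ≡ true → G b a ≡ true
  G-sym {a} {b} h = trans (IsSimple.symm simple b a) h

module Reduction {n} {G : Adj n} (simple : IsSimple G) (F : Figure6a G)
                 (φ : TotalColoring 9 (deleteEdge G (Figure6a.v F) (Figure6a.w₄ F))) where
  open Figure6a F
  open IsSimple simple
  open TotalColoring φ

  G′ : Adj n
  G′ = deleteEdge G v w₄

  core : List (Fin n)
  core = v ∷ w₁ ∷ w₂ ∷ w₃ ∷ w₄ ∷ w₅ ∷ []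

  τ : Fin 6 → Fin n
  τ = lookup core

  τ-injective : ∀ {r s} → τ r ≡ τ s → r ≡ s
  τ-injective = lookup-injective core-unique

  core-distinct : (rs : List (Fin 6)) → {True (unique? Fin._≟_ rs)} → Unique (map τ rs)
  core-distinct rs {rs-unique} = Unique.map⁺ τ-injective (toWitness rs-unique)

  core-≢ : ∀ r s → {False (r Fin.≟ s)} → τ r ≢ τ s
  core-≢ r s {r≢s} τr≡τs = toWitnessFalse r≢s (τ-injective τr≡τs)

  ∉core⇒≢ : ∀ {y} → y ∉ core → ∀ s → y ≢ τ s
  ∉core⇒≢ y∉ s refl = y∉ (∈-lookup s)

  G-sym : ∀ {a b} → G a b ≡ true → G b a ≡ true
  G-sym {a} {b} h = trans (symm b a) h

  from-v : ∀ {b} → G v b ≡ true → b ≢ w₄ → G′ v b ≡ true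
  from-v h b≢w₄ = deleteEdge-true G h (λ (_ , b≡w₄) → b≢w₄ b≡w₄) (λ (v≡w₄ , _) → core-≢ (# 0) (# 4) v≡w₄)

  from-w₄ : ∀ {b} → G w₄ b ≡ true → b ≢ v → G′ w₄ b ≡ true
  from-w₄ h b≢v = deleteEdge-true G h (λ (w₄≡v , _) → core-≢ (# 4) (# 0) w₄≡v) (λ (_ , b≡v) → b≢v b≡v)

  from-other : ∀ {a b} → G a b ≡ true → a ≢ v → a ≢ w₄ → G′ a b ≡ true
  from-other h a≢v a≢w₄ = deleteEdge-true G h (λ (a≡v , _) → a≢v a≡v) (λ (a≡w₄ , _) → a≢w₄ a≡w₄)

  vw₁∈G′ : G′ v w₁ ≡ true
  vw₁∈G′ = from-v v∼w₁ (core-≢ (# 1) (# 4))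
  vw₂∈G′ : G′ v w₂ ≡ true
  vw₂∈G′ = from-v v∼w₂ (core-≢ (# 2) (# 4))
  vw₃∈G′ : G′ v w₃ ≡ true
  vw₃∈G′ = from-v v∼w₃ (core-≢ (# 3) (# 4))
  vw₅∈G′ : G′ v w₅ ≡ true
  vw₅∈G′ = from-v v∼w₅ (core-≢ (# 5) (# 4))
  w₁v∈G′ : G′ w₁ v ≡ true
  w₁v∈G′ = from-other (G-sym v∼w₁) (core-≢ (# 1) (# 0)) (core-≢ (# 1) (# 4))
  w₁w₂∈G′ : G′ w₁ w₂ ≡ true
  w₁w₂∈G′ = from-other w₁∼w₂ (core-≢ (# 1) (# 0)) (core-≢ (# 1) (# 4))
  w₂v∈G′ : G′ w₂ v ≡ true
  w₂v∈G′ = from-other (G-sym v∼w₂) (core-≢ (# 2) (# 0)) (core-≢ (# 2) (# 4))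
  w₂w₁∈G′ : G′ w₂ w₁ ≡ true
  w₂w₁∈G′ = from-other (G-sym w₁∼w₂) (core-≢ (# 2) (# 0)) (core-≢ (# 2) (# 4))
  w₂w₃∈G′ : G′ w₂ w₃ ≡ true
  w₂w₃∈G′ = from-other w₂∼w₃ (core-≢ (# 2) (# 0)) (core-≢ (# 2) (# 4))
  w₃v∈G′ : G′ w₃ v ≡ true
  w₃v∈G′ = from-other (G-sym v∼w₃) (core-≢ (# 3) (# 0)) (core-≢ (# 3) (# 4))
  w₃w₂∈G′ : G′ w₃ w₂ ≡ true
  w₃w₂∈G′ = from-other (G-sym w₂∼w₃) (core-≢ (# 3) (# 0)) (core-≢ (# 3) (# 4))
  w₃w₄∈G′ : G′ w₃ w₄ ≡ true
  w₃w₄∈G′ = from-other w₃∼w₄ (core-≢ (# 3) (# 0)) (core-≢ (# 3) (# 4))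
  w₄w₃∈G′ : G′ w₄ w₃ ≡ true
  w₄w₃∈G′ = from-w₄ (G-sym w₃∼w₄) (core-≢ (# 3) (# 0))
  w₄x∈G′ : G′ w₄ x ≡ true
  w₄x∈G′ = from-w₄ w₄∼x (∉core⇒≢ x∉core (# 0))
  w₅v∈G′ : G′ w₅ v ≡ true
  w₅v∈G′ = from-other (G-sym v∼w₅) (core-≢ (# 5) (# 0)) (core-≢ (# 5) (# 4))
  w₅x∈G′ : G′ w₅ x ≡ true
  w₅x∈G′ = from-other w₅∼x (core-≢ (# 5) (# 0)) (core-≢ (# 5) (# 4))
  w₅w₆∈G′ : G′ w₅ w₆ ≡ true
  w₅w₆∈G′ = from-other w₅∼w₆ (core-≢ (# 5) (# 0)) (core-≢ (# 5) (# 4))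

  -- Here and below, opaque: unfolding these proofs during conversion checking is prohibitively
  -- expensive.
  opaque
    missing-at-v : ∃ λ c → c ≢ vcol v × (∀ z → G′ v z ≡ true → c ≢ ecol v z)
    missing-at-v = ∃-missingColour φ v (subst (λ d → suc d < 9) (sym deg′-v) ≤-refl)
      where
      deg′-v : deg G′ v ≡ 7
      deg′-v = suc-injective (trans (sym (deg-deleteEdge G v∼w₄ (core-≢ (# 0) (# 4)))) deg-v)

  α : Fin 9
  α = proj₁ missing-at-v

  α≢vcol : α ≢ vcol v
  α≢vcol = proj₁ (proj₂ missing-at-v)

  α-missing : ∀ z → G′ v z ≡ true → α ≢ ecol v z
  α-missing = proj₂ (proj₂ missing-at-v)

  a₁ a₂ a₃ a₅ c₁₂ c₂₃ c₃₄ c₄ₓ c₅ₓ c₅₆ : Fin 9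
  a₁ = ecol v w₁
  a₂ = ecol v w₂
  a₃ = ecol v w₃
  a₅ = ecol v w₅
  c₁₂ = ecol w₁ w₂
  c₂₃ = ecol w₃ w₂
  c₃₄ = ecol w₃ w₄
  c₄ₓ = ecol w₄ x
  c₅ₓ = ecol w₅ x
  c₅₆ = ecol w₅ w₆

  old-at-v : Unique (a₁ ∷ a₂ ∷ a₃ ∷ α ∷ a₅ ∷ [])
  old-at-v = Unique-resp-↭ (↭-sym (shift α (a₁ ∷ a₂ ∷ a₃ ∷ []) (a₅ ∷ [])))
    ((α-missing w₁ vw₁∈G′ ∷ α-missing w₂ vw₂∈G′ ∷ α-missing w₃ vw₃∈G′ ∷ α-missing w₅ vw₅∈G′ ∷ []) ∷
     ecol-unique φ (core-distinct (# 1 ∷ # 2 ∷ # 3 ∷ # 5 ∷ [])) (vw₁∈G′ ∷ vw₂∈G′ ∷ vw₃∈G′ ∷ vw₅∈G′ ∷ []))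

  old-at-w₂ : Unique (a₂ ∷ c₁₂ ∷ c₂₃ ∷ [])
  old-at-w₂ rewrite ecol-sym v w₂ vw₂∈G′ | ecol-sym w₁ w₂ w₁w₂∈G′ | ecol-sym w₃ w₂ w₃w₂∈G′ =
    ecol-unique φ (core-distinct (# 0 ∷ # 1 ∷ # 3 ∷ [])) (w₂v∈G′ ∷ w₂w₁∈G′ ∷ w₂w₃∈G′ ∷ [])

  old-at-w₃ : Unique (a₃ ∷ c₂₃ ∷ c₃₄ ∷ [])
  old-at-w₃ rewrite ecol-sym v w₃ vw₃∈G′ =
    ecol-unique φ (core-distinct (# 0 ∷ # 2 ∷ # 4 ∷ [])) (w₃v∈G′ ∷ w₃w₂∈G′ ∷ w₃w₄∈G′ ∷ [])

  old-at-w₅ : Unique (a₅ ∷ c₅ₓ ∷ c₅₆ ∷ [])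
  old-at-w₅ rewrite ecol-sym v w₅ vw₅∈G′ =
    ecol-unique φ (distinct₃ (≢-sym (∉core⇒≢ x∉core (# 0))) (≢-sym (∉core⇒≢ w₆∉core (# 0))) (≢-sym w₆≢x))
                  (w₅v∈G′ ∷ w₅x∈G′ ∷ w₅w₆∈G′ ∷ [])

  old : OldColours a₁ a₂ a₃ a₅ α c₁₂ c₂₃ c₃₄ c₄ₓ c₅ₓ c₅₆
  old = record
    { at-v  = old-at-v
    ; at-w₁ = λ eq → ee-proper w₁ v w₂ w₁v∈G′ w₁w₂∈G′ (core-≢ (# 0) (# 2))
                               (trans (sym (ecol-sym v w₁ vw₁∈G′)) eq)
    ; at-w₂ = old-at-w₂
    ; at-w₃ = old-at-w₃
    ; at-w₄ = λ eq → ee-proper w₄ w₃ x w₄w₃∈G′ w₄x∈G′ (≢-sym (∉core⇒≢ x∉core (# 3)))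
                               (trans (sym (ecol-sym w₃ w₄ w₃w₄∈G′)) eq)
    ; at-w₅ = old-at-w₅
    }

  opaque
    new : Recolouring a₁ a₂ a₃ a₅ α c₁₂ c₂₃ c₃₄ c₄ₓ c₅ₓ c₅₆
    new = recolour Fin._≟_ old

  open Recolouring new

  opaque
    c₂-fresh : ∃ (_∉ vcol v ∷ vcol w₁ ∷ vcol w₃ ∷ A₂ ∷ C₁₂ ∷ C₂₃ ∷ [])
    c₂-fresh = ∃-∉ _ (m≤m+n 7 2)

    c₄-fresh : ∃ (_∉ vcol v ∷ vcol w₃ ∷ vcol x ∷ A₄ ∷ C₃₄ ∷ c₄ₓ ∷ [])
    c₄-fresh = ∃-∉ _ (m≤m+n 7 2)

    c₅-fresh : ∃ (_∉ vcol v ∷ vcol x ∷ vcol w₆ ∷ A₅ ∷ c₅ₓ ∷ c₅₆ ∷ [])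
    c₅-fresh = ∃-∉ _ (m≤m+n 7 2)

  -- The recoloured vertices v, w₁, …, w₅ are τ 0, …, τ 5; the tables are indexed by their numbers,
  -- an edge by the smaller number first.
  edgeTable : ℕ → ℕ → Maybe (Fin 9)
  edgeTable 0 1 = just A₁
  edgeTable 0 2 = just A₂
  edgeTable 0 3 = just A₃
  edgeTable 0 4 = just A₄
  edgeTable 0 5 = just A₅
  edgeTable 1 2 = just C₁₂
  edgeTable 2 3 = just C₂₃
  edgeTable 3 4 = just C₃₄
  edgeTable _ _ = nothing

  c₂ c₄ c₅ : Fin 9
  c₂ = proj₁ c₂-fresh
  c₄ = proj₁ c₄-fresh
  c₅ = proj₁ c₅-fresh

  c₂∉ : c₂ ∉ vcol v ∷ vcol w₁ ∷ vcol w₃ ∷ A₂ ∷ C₁₂ ∷ C₂₃ ∷ []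
  c₂∉ = proj₂ c₂-fresh

  c₄∉ : c₄ ∉ vcol v ∷ vcol w₃ ∷ vcol x ∷ A₄ ∷ C₃₄ ∷ c₄ₓ ∷ []
  c₄∉ = proj₂ c₄-fresh

  c₅∉ : c₅ ∉ vcol v ∷ vcol x ∷ vcol w₆ ∷ A₅ ∷ c₅ₓ ∷ c₅₆ ∷ []
  c₅∉ = proj₂ c₅-fresh

  vertexTable : ℕ → Maybe (Fin 9)
  vertexTable 2 = just c₂
  vertexTable 4 = just c₄
  vertexTable 5 = just c₅
  vertexTable _ = nothing

  newEdge : Fin 6 → Fin 6 → Maybe (Fin 9)
  newEdge r s = edgeTable (toℕ r ⊓ toℕ s) (toℕ r ⊔ toℕ s)

  newEdge-sym : ∀ r s → newEdge r s ≡ newEdge s r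
  newEdge-sym r s = cong₂ edgeTable (⊓-comm (toℕ r) (toℕ s)) (⊔-comm (toℕ r) (toℕ s))

  newVertex : Fin 6 → Maybe (Fin 9)
  newVertex r = vertexTable (toℕ r)

  only-vw₄-deleted : ∀ {a b} → G a b ≡ true → G′ a b ≡ false →
    ∃₂ λ r s → a ≡ τ r × b ≡ τ s × newEdge r s ≢ nothing × (newVertex r ≢ nothing ⊎ newVertex s ≢ nothing)
  only-vw₄-deleted h gone with deleteEdge-false G h gone
  ... | inj₁ (refl , refl) = # 0 , # 4 , refl , refl , (λ ()) , inj₂ (λ ())
  ... | inj₂ (refl , refl) = # 4 , # 0 , refl , refl , (λ ()) , inj₁ (λ ())

  open LocalRecolouring (λ a b → symm a b) φ τ τ-injective newEdge newEdge-sym newVertex only-vw₄-deleted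
  core-stable : ∀ r → newVertex r ≡ nothing → ∀ {s} → τ r ≡ τ s → newVertex s ≡ nothing
  core-stable r r-stable {s} eq with τ-injective {r} {s} eq
  ... | refl = r-stable

  outside-stable : ∀ {y} → y ∉ core → ∀ s → y ≡ τ s → newVertex s ≡ nothing
  outside-stable y∉ s y≡τs = ⊥-elim (∉core⇒≢ y∉ s y≡τs)

  ≢-last : ∀ {A : Set} {p q r c : A} → Unique (p ∷ q ∷ r ∷ []) → c ∈ p ∷ q ∷ [] → c ≢ r
  ≢-last ((_ ∷ p≢r ∷ []) ∷ _) (here refl) = p≢r
  ≢-last (_ ∷ (q≢r ∷ []) ∷ _) (there (here refl)) = q≢r

  only-x : ∀ {b} → G′ w₄ b ≡ true → b ∉ v ∷ w₃ ∷ [] → b ≡ x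
  only-x h b∉ with N-w₄ (deleteEdge⊆ G h)
  ... | here b≡v = ⊥-elim (b∉ (here b≡v))
  ... | there (here b≡w₃) = ⊥-elim (b∉ (there (here b≡w₃)))
  ... | there (there (here b≡x)) = b≡x

  x-or-w₆ : ∀ {b} → G′ w₅ b ≡ true → b ∉ v ∷ [] → b ≡ x ⊎ b ≡ w₆
  x-or-w₆ h b∉ with N-w₅ (deleteEdge⊆ G h)
  ... | here b≡v = ⊥-elim (b∉ (here b≡v))
  ... | there (here b≡x) = inj₁ b≡x
  ... | there (there (here b≡w₆)) = inj₂ b≡w₆

  star-v : StarCondition (# 0)
  star-v = permutedStar (# 0) refl at-v old-at-v admissible
    where
    admissible : ∀ {o} → o ∈ a₁ ∷ a₂ ∷ a₃ ∷ α ∷ a₅ ∷ [] → Admissible (# 0) o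
    admissible (here refl)                                 = ecol-admissible φ vw₁∈G′ (here refl)
    admissible (there (here refl))                         = ecol-admissible φ vw₂∈G′ (there (here refl))
    admissible (there (there (here refl)))                 = ecol-admissible φ vw₃∈G′ (there (there (here refl)))
    admissible (there (there (there (here refl))))         = α≢vcol , λ h _ → α-missing _ h
    admissible (there (there (there (there (here refl))))) =
      ecol-admissible φ vw₅∈G′ (there (there (there (there (here refl)))))

  star-w₁ : StarCondition (# 1)
  star-w₁ = permutedStar (# 1) refl at-w₁ ((OldColours.at-w₁ old ∷ []) ∷ [] ∷ []) admissible
    where
    admissible : ∀ {o} → o ∈ a₁ ∷ c₁₂ ∷ [] → Admissible (# 1) o
    admissible (here refl) =
      subst (Admissible (# 1)) (sym (ecol-sym v w₁ vw₁∈G′)) (ecol-admissible φ w₁v∈G′ (here refl))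
    admissible (there (here refl)) = ecol-admissible φ w₁w₂∈G′ (there (here refl))

  star-w₃ : StarCondition (# 3)
  star-w₃ = permutedStar (# 3) refl at-w₃ old-at-w₃ admissible
    where
    admissible : ∀ {o} → o ∈ a₃ ∷ c₂₃ ∷ c₃₄ ∷ [] → Admissible (# 3) o
    admissible (here refl) =
      subst (Admissible (# 3)) (sym (ecol-sym v w₃ vw₃∈G′)) (ecol-admissible φ w₃v∈G′ (here refl))
    admissible (there (here refl)) = ecol-admissible φ w₃w₂∈G′ (there (here refl))
    admissible (there (there (here refl))) = ecol-admissible φ w₃w₄∈G′ (there (there (here refl)))

  star-w₂ : StarCondition (# 2)
  star-w₂ = record
    { new-unique  = at-w₂
    ; new≢kept    = λ _ h b∉ → ⊥-elim (b∉ (N-w₂ (deleteEdge⊆ G h)))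
    ; vertex∉new  = λ c₂∈ → c₂∉ (there (there (there c₂∈)))
    ; vertex≢kept = λ h b∉ → ⊥-elim (b∉ (N-w₂ (deleteEdge⊆ G h)))
    }

  star-w₄ : StarCondition (# 4)
  star-w₄ = record
    { new-unique  = take⁺ 2 at-w₄
    ; new≢kept    = λ c∈ h b∉ → subst (λ b → _ ≢ ecol w₄ b) (sym (only-x h b∉)) (≢-last at-w₄ c∈)
    ; vertex∉new  = λ c₄∈ → c₄∉ (there (there (there (∈-++⁺ˡ c₄∈))))
    ; vertex≢kept = λ h b∉ c₄≡ → c₄∉ (there (there (there (there (there (here
                      (trans c₄≡ (cong (ecol w₄) (only-x h b∉)))))))))
    }

  star-w₅ : StarCondition (# 5)
  star-w₅ = record
    { new-unique  = [] ∷ []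
    ; new≢kept    = λ { (here refl) h b∉ → avoid (x-or-w₆ h b∉) }
    ; vertex∉new  = λ c₅∈ → c₅∉ (there (there (there (∈-++⁺ˡ c₅∈))))
    ; vertex≢kept = λ h b∉ → c₅-avoid (x-or-w₆ h b∉)
    }
    where
    avoid : ∀ {b} → b ≡ x ⊎ b ≡ w₆ → A₅ ≢ ecol w₅ b
    avoid with at-w₅
    ... | (A₅≢c₅ₓ ∷ A₅≢c₅₆ ∷ []) ∷ _ = λ { (inj₁ refl) → A₅≢c₅ₓ ; (inj₂ refl) → A₅≢c₅₆ }
    c₅-avoid : ∀ {b} → b ≡ x ⊎ b ≡ w₆ → c₅ ≢ ecol w₅ b
    c₅-avoid (inj₁ refl) c₅≡ = c₅∉ (there (there (there (there (here c₅≡)))))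
    c₅-avoid (inj₂ refl) c₅≡ = c₅∉ (there (there (there (there (there (here c₅≡))))))

  fresh-w₂ : FreshVertex (# 2) c₂
  fresh-w₂ b h with N-w₂ h
  ... | here refl                 = (λ _ → core-stable (# 0) refl) , λ eq → c₂∉ (here eq)
  ... | there (here refl)         = (λ _ → core-stable (# 1) refl) , λ eq → c₂∉ (there (here eq))
  ... | there (there (here refl)) = (λ _ → core-stable (# 3) refl) , λ eq → c₂∉ (there (there (here eq)))

  fresh-w₄ : FreshVertex (# 4) c₄
  fresh-w₄ b h with N-w₄ h
  ... | here refl                 = (λ _ → core-stable (# 0) refl) , λ eq → c₄∉ (here eq)
  ... | there (here refl)         = (λ _ → core-stable (# 3) refl) , λ eq → c₄∉ (there (here eq))
  ... | there (there (here refl)) = outside-stable x∉core , λ eq → c₄∉ (there (there (here eq)))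

  fresh-w₅ : FreshVertex (# 5) c₅
  fresh-w₅ b h with N-w₅ h
  ... | here refl                 = (λ _ → core-stable (# 0) refl) , λ eq → c₅∉ (here eq)
  ... | there (here refl)         = outside-stable x∉core , λ eq → c₅∉ (there (here eq))
  ... | there (there (here refl)) = outside-stable w₆∉core , λ eq → c₅∉ (there (there (here eq)))

  stars : ∀ r → StarCondition r
  stars Fin.zero = star-v
  stars (Fin.suc Fin.zero) = star-w₁
  stars (Fin.suc (Fin.suc Fin.zero)) = star-w₂
  stars (Fin.suc (Fin.suc (Fin.suc Fin.zero))) = star-w₃
  stars (Fin.suc (Fin.suc (Fin.suc (Fin.suc Fin.zero)))) = star-w₄
  stars (Fin.suc (Fin.suc (Fin.suc (Fin.suc (Fin.suc Fin.zero))))) = star-w₅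

  fresh : ∀ r {c} → newVertex r ≡ just c → FreshVertex r c
  fresh (Fin.suc (Fin.suc Fin.zero)) refl = fresh-w₂
  fresh (Fin.suc (Fin.suc (Fin.suc (Fin.suc Fin.zero)))) refl = fresh-w₄
  fresh (Fin.suc (Fin.suc (Fin.suc (Fin.suc (Fin.suc Fin.zero))))) refl = fresh-w₅

  colouring : TotalColoring 9 G
  colouring = totalColouring stars fresh

lemma2p10 : ∀ {n : ℕ} (G : Adj n) → MinimalCounterexample G → ¬ Config G
lemma2p10 G mc config = notColorable (Reduction.colouring simple F (edgeDel v w₄ v∼w₄))
  where
  open MinimalCounterexample mc
  simple : IsSimple G
  simple = proj₁ inClass
  F : Figure6a G
  F = figure6a simple config
  open Figure6a F using (v; w₄; v∼w₄)
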